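{- Let $G$ be an integral sum graph with at least two vertices. If $G$ has a kernel of dimension at least $2$, then $G$ has infinitely many primitive labellings.
   Context: A graph $G$ with vertex set $\{1,\dots,n\}$ is an integral sum graph ($\mathbb{Z}$-graph) if there is an injective map $\lambda:V(G)\to\mathbb{Z}$ (a labelling) such that two distinct vertices $i,j$ are adjacent if and only if $\lambda(i)+\lambda(j)\in\lambda(V(G))$. Given a labelling $\lambda$ of $G$, consider the homogeneous linear system in unknowns $x_1,\dots,x_n$ consisting of the equations $x_i+x_j=x_k$, one for each edge $\{i,j\}$ of $G$, where $k$ is the vertex with $\lambda(i)+\lambda(j)=\lambda(k)$. The nullspace over $\mathbb{Q}$ of this system is the kernel of the labelling $\lambda$; a kernel of $G$ is the kernel of some labelling of $G$. A labelling is primitive if it is not equal to $c\mu$ for some labelling $\mu$ of $G$ and some integer $c$ with $|c|>1$. -}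

module Defs where

import Data.Nat
open import Data.Nat using (ℕ)
open import Data.Fin using (Fin)
open import Data.Integer as ℤ using (ℤ)
open import Data.Rational as ℚ using (ℚ)
open import Data.Product using (Σ; ∃; _×_; _,_)
open import Data.List using (List)
open import Data.List.Relation.Unary.All using (All)
open import Function.Bundles using (_⇔_)
open import Function.Definitions using (Injective)
open import Relation.Binary.PropositionalEquality using (_≡_; _≢_)
open import Relation.Nullary using (¬_)
open import Level using (0ℓ)

record Graph (n : ℕ) : Set₁ where
  field
    Adj     : Fin n → Fin n → Set
    Adj-sym : ∀ {i j} → Adj i j → Adj j i
    Adj-irr : ∀ {i} → ¬ Adj i i
open Graph public

IsLabelling : ∀ {n} → Graph n → (Fin n → ℤ) → Set
IsLabelling {n} G lab =
  Injective _≡_ _≡_ lab ×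
  (∀ (i j : Fin n) → i ≢ j → (Adj G i j ⇔ ∃ λ (k : Fin n) → lab i ℤ.+ lab j ≡ lab k))

IsIntegralSumGraph : ∀ {n} → Graph n → Set
IsIntegralSumGraph {n} G = Σ (Fin n → ℤ) λ lab → IsLabelling G lab

InKernel : ∀ {n} → Graph n → (Fin n → ℤ) → (Fin n → ℚ) → Set
InKernel {n} G lab x =
  ∀ (i j k : Fin n) → i ≢ j → Adj G i j → lab i ℤ.+ lab j ≡ lab k →
    x i ℚ.+ x j ≡ x k

LinIndep₂ : ∀ {n} → (Fin n → ℚ) → (Fin n → ℚ) → Set
LinIndep₂ u v =
  ∀ (a b : ℚ) → (∀ i → a ℚ.* u i ℚ.+ b ℚ.* v i ≡ ℚ.0ℚ) → (a ≡ ℚ.0ℚ × b ≡ ℚ.0ℚ)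

KernelDimAtLeast2 : ∀ {n} → Graph n → (Fin n → ℤ) → Set
KernelDimAtLeast2 {n} G lab =
  Σ (Fin n → ℚ) λ u → Σ (Fin n → ℚ) λ v →
    InKernel G lab u × InKernel G lab v × LinIndep₂ u v

HasKernelDimAtLeast2 : ∀ {n} → Graph n → Set
HasKernelDimAtLeast2 {n} G =
  Σ (Fin n → ℤ) λ lab → IsLabelling G lab × KernelDimAtLeast2 G lab

IsPrimitive : ∀ {n} → Graph n → (Fin n → ℤ) → Set
IsPrimitive {n} G lab =
  ¬ (Σ ℤ λ c → Σ (Fin n → ℤ) λ μ →
       (1 Data.Nat.< ℤ.∣ c ∣) × IsLabelling G μ × (∀ i → lab i ≡ c ℤ.* μ i))

-- G has infinitely many primitive labellings: no finite list exhausts them.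
InfinitelyManyPrimitiveLabellings : ∀ {n} → Graph n → Set
InfinitelyManyPrimitiveLabellings {n} G =
  ∀ (L : List (Fin n → ℤ)) →
    Σ (Fin n → ℤ) λ lab →
      IsLabelling G lab × IsPrimitive G lab × All (λ μ → ¬ (∀ i → lab i ≡ μ i)) L

-- If x is an integer kernel vector of a labelling λ, then N·λ + x is again a
-- labelling for every large N: the perturbation x respects the sums of λ and is
-- too small to create new ones. Dividing N·λ + x by its content makes it
-- primitive. Two independent kernel vectors supply an x with a nonzero 2×2 minor
-- against λ at some vertices p, q; a labelling ℓ proportional to N·λ + x then has
-- N·minor(ℓ,λ) + minor(ℓ,x) = 0, so once N exceeds ∣minor(ℓ,x)∣ both minors
-- vanish and ℓ vanishes at p and q, impossible for an injective labelling.
-- Choosing N beyond this bound for every ℓ in a given finite list yields a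
-- primitive labelling outside the list.
module Submission where

open import Defs
open import Data.Empty using (⊥-elim)
open import Data.Fin using (Fin; zero; suc)
open import Data.Fin.Properties using (all?; ¬∀⟶∃¬)
open import Data.Integer as ℤ using (ℤ; +_; -_; _+_; _*_; _-_; ∣_∣; 0ℤ; 1ℤ; _≟_)
import Data.Integer.Properties as ℤ
open import Data.Integer.Divisibility.Signed using (_∣_; ∣ᵤ⇒∣)
open import Data.Integer.Tactic.RingSolver using (solve-∀)
open import Data.List using (_∷_; map; allFin)
open import Data.List.Membership.Propositional using (_∈_)
open import Data.List.Membership.Propositional.Properties using (∈-allFin)
open import Data.List.Relation.Unary.Any using (here; there)
import Data.List.Relation.Unary.All as All
open import Data.Nat as ℕ using (ℕ; _≤_; _<_)
import Data.Nat.Divisibility as ℕ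
import Data.Nat.Properties as ℕ
open import Data.Nat.GCD using (gcd; gcd[m,n]∣m; gcd[m,n]∣n; gcd-greatest)
open import Data.Nat.ListAction using (sum)
open import Data.Product using (Σ; ∃; ∃₂; _×_; _,_; proj₁; proj₂)
open import Data.Rational as ℚ using (ℚ; mkℚ; ↥_; ↧_)
open import Data.Rational.Literals using (fromℤ)
import Data.Rational.Properties as ℚ
open import Data.Rational.Unnormalised using (*≡*)
import Data.Rational.Unnormalised.Properties as ℚᵘ
open import Data.Sum using (inj₁; inj₂)
open import Function using (_∘_)
open import Function.Bundles using (_⇔_; mk⇔; Equivalence)
open import Relation.Binary.PropositionalEquality
open import Relation.Nullary using (¬_; yes; no)

open ≡-Reasoning

i*j≡0⇒j≢0⇒i≡0 : ∀ i {j} → i * j ≡ 0ℤ → j ≢ 0ℤ → i ≡ 0ℤ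
i*j≡0⇒j≢0⇒i≡0 i ij≡0 j≢0 with ℤ.i*j≡0⇒i≡0∨j≡0 i ij≡0
... | inj₁ i≡0 = i≡0
... | inj₂ j≡0 = ⊥-elim (j≢0 j≡0)

i≢0⇒j≢0⇒i*j≢0 : ∀ {i j} → i ≢ 0ℤ → j ≢ 0ℤ → i * j ≢ 0ℤ
i≢0⇒j≢0⇒i*j≢0 {i} i≢0 j≢0 ij≡0 = i≢0 (i*j≡0⇒j≢0⇒i≡0 i ij≡0 j≢0)

∣N*a∣<N⇒a≡0 : ∀ {N} a → ∣ + N * a ∣ < N → a ≡ 0ℤ
∣N*a∣<N⇒a≡0 {N} a ∣Na∣<N with a ≟ 0ℤ
... | yes a≡0 = a≡0
... | no a≢0  = ⊥-elim (ℕ.<⇒≱ ∣Na∣<N N≤∣Na∣)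
  where
  instance _ = ℕ.≢-nonZero (a≢0 ∘ ℤ.∣i∣≡0⇒i≡0)
  N≤∣Na∣ : N ≤ ∣ + N * a ∣
  N≤∣Na∣ = subst (N ≤_) (sym (ℤ.abs-* (+ N) a)) (ℕ.m≤m*n N ∣ a ∣)

+N*a+b≡0⇒a≡0×b≡0 : ∀ {N} a b → ∣ b ∣ < N → + N * a + b ≡ 0ℤ → a ≡ 0ℤ × b ≡ 0ℤ
+N*a+b≡0⇒a≡0×b≡0 {N} a b ∣b∣<N Na+b≡0 = a≡0 , b≡0
  where
  cancelˡ : ∀ x y → x ≡ (x + y) - y
  cancelˡ = solve-∀
  Na≡-b : + N * a ≡ - b
  Na≡-b = begin
    + N * a            ≡⟨ cancelˡ (+ N * a) b ⟩
    (+ N * a + b) - b  ≡⟨ cong (_- b) Na+b≡0 ⟩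
    0ℤ - b             ≡⟨ ℤ.+-identityˡ (- b) ⟩
    - b                ∎
  a≡0 : a ≡ 0ℤ
  a≡0 = ∣N*a∣<N⇒a≡0 a (subst (_< N) (sym (trans (cong ∣_∣ Na≡-b) (ℤ.∣-i∣≡∣i∣ b))) ∣b∣<N)
  b≡0 : b ≡ 0ℤ
  b≡0 = begin
    b             ≡⟨ ℤ.+-identityˡ b ⟨
    0ℤ + b        ≡⟨ cong (_+ b) (ℤ.*-zeroʳ (+ N)) ⟨
    + N * 0ℤ + b  ≡⟨ cong (λ c → + N * c + b) a≡0 ⟨
    + N * a + b   ≡⟨ Na+b≡0 ⟩
    0ℤ            ∎

+N*a+b≡+N*c+d⇒a≡c : ∀ {N} a b c d → ∣ b - d ∣ < N → + N * a + b ≡ + N * c + d → a ≡ c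
+N*a+b≡+N*c+d⇒a≡c {N} a b c d ∣b-d∣<N eq =
  ℤ.i-j≡0⇒i≡j a c (proj₁ (+N*a+b≡0⇒a≡0×b≡0 (a - c) (b - d) ∣b-d∣<N
    (trans (difference (+ N) a b c d) (ℤ.i≡j⇒i-j≡0 eq))))
  where
  difference : ∀ n a b c d → n * (a - c) + (b - d) ≡ (n * a + b) - (n * c + d)
  difference = solve-∀

≤-sum-map : ∀ {A : Set} (f : A → ℕ) {a xs} → a ∈ xs → f a ≤ sum (map f xs)
≤-sum-map f (here refl)            = ℕ.m≤m+n _ _
≤-sum-map f {xs = y ∷ _} (there a∈) = ℕ.≤-trans (≤-sum-map f a∈) (ℕ.m≤n+m _ (f y))

module _ {n : ℕ} where

  minor : (Fin n → ℤ) → (Fin n → ℤ) → Fin n → Fin n → ℤ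
  minor x y p q = x p * y q - x q * y p

  minor≢0⇒distinct : ∀ x y {p q} → minor x y p q ≢ 0ℤ → p ≢ q
  minor≢0⇒distinct x y {p} minor≢0 refl = minor≢0 (ℤ.+-inverseʳ (x p * y p))

  -- Cramer's rule: c p · minor a b and c q · minor a b are combinations of
  -- minor c a and minor c b.
  minor-vanishing : ∀ a b c {p q} → minor a b p q ≢ 0ℤ →
                    minor c a p q ≡ 0ℤ → minor c b p q ≡ 0ℤ → c p ≡ 0ℤ × c q ≡ 0ℤ
  minor-vanishing a b c {p} {q} ab≢0 ca≡0 cb≡0 =
    i*j≡0⇒j≢0⇒i≡0 (c p) cp-vanishes ab≢0 , i*j≡0⇒j≢0⇒i≡0 (c q) cq-vanishes ab≢0
    where
    expand-p : ∀ ap aq bp bq cp cq →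
               cp * (ap * bq - aq * bp) ≡ ap * (cp * bq - cq * bp) - bp * (cp * aq - cq * ap)
    expand-p = solve-∀
    expand-q : ∀ ap aq bp bq cp cq →
               cq * (ap * bq - aq * bp) ≡ aq * (cp * bq - cq * bp) - bq * (cp * aq - cq * ap)
    expand-q = solve-∀
    annihilate : ∀ s t → s * 0ℤ - t * 0ℤ ≡ 0ℤ
    annihilate = solve-∀
    cp-vanishes : c p * minor a b p q ≡ 0ℤ
    cp-vanishes = begin
      c p * minor a b p q                                ≡⟨ expand-p (a p) (a q) (b p) (b q) (c p) (c q) ⟩
      a p * minor c b p q - b p * minor c a p q          ≡⟨ cong₂ (λ s t → a p * s - b p * t) cb≡0 ca≡0 ⟩
      a p * 0ℤ - b p * 0ℤ                                ≡⟨ annihilate (a p) (b p) ⟩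
      0ℤ                                                 ∎
    cq-vanishes : c q * minor a b p q ≡ 0ℤ
    cq-vanishes = begin
      c q * minor a b p q                                ≡⟨ expand-q (a p) (a q) (b p) (b q) (c p) (c q) ⟩
      a q * minor c b p q - b q * minor c a p q          ≡⟨ cong₂ (λ s t → a q * s - b q * t) cb≡0 ca≡0 ⟩
      a q * 0ℤ - b q * 0ℤ                                ≡⟨ annihilate (a q) (b q) ⟩
      0ℤ                                                 ∎

  LinIndep₂ℤ : (Fin n → ℤ) → (Fin n → ℤ) → Set
  LinIndep₂ℤ U V = ∀ a b → (∀ i → a * U i + b * V i ≡ 0ℤ) → a ≡ 0ℤ × b ≡ 0ℤ

  linIndep₂ℤ⇒minor≢0 : ∀ {U V} → LinIndep₂ℤ U V → ∃₂ λ p q → minor U V p q ≢ 0ℤ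
  linIndep₂ℤ⇒minor≢0 {U} {V} indep with all? (λ p → U p ≟ 0ℤ)
  ... | yes U≡0 = ⊥-elim (1≢0 (proj₁ (indep 1ℤ 0ℤ λ i → trans (project (U i) (V i)) (U≡0 i))))
    where
    1≢0 : 1ℤ ≢ 0ℤ
    1≢0 ()
    project : ∀ u v → 1ℤ * u + 0ℤ * v ≡ u
    project = solve-∀
  ... | no U≢0 with ¬∀⟶∃¬ n _ (λ p → U p ≟ 0ℤ) U≢0
  ...   | p , Up≢0 with all? (λ q → minor U V p q ≟ 0ℤ)
  ...     | no minor≢0  = p , ¬∀⟶∃¬ n _ (λ q → minor U V p q ≟ 0ℤ) minor≢0
  ...     | yes minor≡0 = ⊥-elim (Up≢0 (ℤ.neg-injective (proj₂ (indep (V p) (- U p) relation))))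
    where
    rearrange : ∀ up vp ui vi → vp * ui + (- up) * vi ≡ - (up * vi - ui * vp)
    rearrange = solve-∀
    relation : ∀ i → V p * U i + (- U p) * V i ≡ 0ℤ
    relation i = trans (rearrange (U p) (V p) (U i) (V i)) (cong -_ (minor≡0 i))

fromℤ-injective : ∀ {a b} → fromℤ a ≡ fromℤ b → a ≡ b
fromℤ-injective = cong ↥_

fromℤ-+ : ∀ a b → fromℤ (a + b) ≡ fromℤ a ℚ.+ fromℤ b
fromℤ-+ a b = ℚ.toℚᵘ-injective (ℚᵘ.≃-sym (ℚᵘ.≃-trans
  (ℚ.toℚᵘ-homo-+ (fromℤ a) (fromℤ b)) (*≡* (cross-multiplied a b))))
  where
  cross-multiplied : ∀ a b → (a * + 1 + b * + 1) * + 1 ≡ (a + b) * (+ 1 * + 1)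
  cross-multiplied = solve-∀

fromℤ-* : ∀ a b → fromℤ (a * b) ≡ fromℤ a ℚ.* fromℤ b
fromℤ-* a b = ℚ.toℚᵘ-injective (ℚᵘ.≃-sym (ℚᵘ.≃-trans
  (ℚ.toℚᵘ-homo-* (fromℤ a) (fromℤ b)) (*≡* (cross-multiplied a b))))
  where
  cross-multiplied : ∀ a b → a * b * + 1 ≡ a * b * (+ 1 * + 1)
  cross-multiplied = solve-∀

↧*≡↥ : ∀ r → fromℤ (↧ r) ℚ.* r ≡ fromℤ (↥ r)
↧*≡↥ r@(mkℚ _ _ _) = ℚ.toℚᵘ-injective (ℚᵘ.≃-trans
  (ℚ.toℚᵘ-homo-* (fromℤ (↧ r)) r) (*≡* (cross-multiplied (↧ r) (↥ r))))
  where
  cross-multiplied : ∀ d n → d * n * + 1 ≡ n * (+ 1 * d)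
  cross-multiplied = solve-∀

module _ {n : ℕ} where

  NonzeroMultiple : (Fin n → ℤ) → (Fin n → ℚ) → Set
  NonzeroMultiple Y y = Σ ℤ λ d → d ≢ 0ℤ × ∀ i → fromℤ (Y i) ≡ fromℤ d ℚ.* y i

  scaled-component : ∀ (Y : Fin n → ℤ) (y : Fin n → ℚ) c d → (∀ i → fromℤ (Y i) ≡ fromℤ d ℚ.* y i) →
                     ∀ i → fromℤ (c * d) ℚ.* y i ≡ fromℤ (c * Y i)
  scaled-component Y y c d Y≡dy i = begin
    fromℤ (c * d) ℚ.* y i               ≡⟨ cong (ℚ._* y i) (fromℤ-* c d) ⟩
    fromℤ c ℚ.* fromℤ d ℚ.* y i         ≡⟨ ℚ.*-assoc (fromℤ c) (fromℤ d) (y i) ⟩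
    fromℤ c ℚ.* (fromℤ d ℚ.* y i)       ≡⟨ cong (fromℤ c ℚ.*_) (Y≡dy i) ⟨
    fromℤ c ℚ.* fromℤ (Y i)             ≡⟨ fromℤ-* c (Y i) ⟨
    fromℤ (c * Y i)                     ∎

  nonzeroMultiple-linIndep₂ : ∀ {U V u v} → NonzeroMultiple U u → NonzeroMultiple V v →
                              LinIndep₂ u v → LinIndep₂ℤ U V
  nonzeroMultiple-linIndep₂ {U} {V} {u} {v} (du , du≢0 , U≡du·u) (dv , dv≢0 , V≡dv·v) indep a b rel =
    i*j≡0⇒j≢0⇒i≡0 a (cong ↥_ (proj₁ scaled-coefficients-vanish)) du≢0 ,
    i*j≡0⇒j≢0⇒i≡0 b (cong ↥_ (proj₂ scaled-coefficients-vanish)) dv≢0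
    where
    relation : ∀ i → fromℤ (a * du) ℚ.* u i ℚ.+ fromℤ (b * dv) ℚ.* v i ≡ ℚ.0ℚ
    relation i = begin
      fromℤ (a * du) ℚ.* u i ℚ.+ fromℤ (b * dv) ℚ.* v i
        ≡⟨ cong₂ ℚ._+_ (scaled-component U u a du U≡du·u i) (scaled-component V v b dv V≡dv·v i) ⟩
      fromℤ (a * U i) ℚ.+ fromℤ (b * V i)  ≡⟨ fromℤ-+ (a * U i) (b * V i) ⟨
      fromℤ (a * U i + b * V i)            ≡⟨ cong fromℤ (rel i) ⟩
      ℚ.0ℚ                                 ∎
    scaled-coefficients-vanish : fromℤ (a * du) ≡ ℚ.0ℚ × fromℤ (b * dv) ≡ ℚ.0ℚ
    scaled-coefficients-vanish = indep (fromℤ (a * du)) (fromℤ (b * dv)) relation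

clearDenominators : ∀ {n} (y : Fin n → ℚ) → ∃ λ Y → NonzeroMultiple Y y
clearDenominators {ℕ.zero}  y = (λ ()) , 1ℤ , (λ ()) , (λ ())
clearDenominators {ℕ.suc n} y with clearDenominators (y ∘ suc)
... | Y , d , d≢0 , Y≡dy = Y′ , ↧ y₀ * d , i≢0⇒j≢0⇒i*j≢0 {↧ y₀} (λ ()) d≢0 , Y′≡d′y
  where
  y₀ : ℚ
  y₀ = y zero
  Y′ : Fin (ℕ.suc n) → ℤ
  Y′ zero    = ↥ y₀ * d
  Y′ (suc i) = ↧ y₀ * Y i
  Y′≡d′y : ∀ i → fromℤ (Y′ i) ≡ fromℤ (↧ y₀ * d) ℚ.* y i
  Y′≡d′y zero = begin
    fromℤ (↥ y₀ * d)                     ≡⟨ fromℤ-* (↥ y₀) d ⟩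
    fromℤ (↥ y₀) ℚ.* fromℤ d             ≡⟨ cong (ℚ._* fromℤ d) (↧*≡↥ y₀) ⟨
    fromℤ (↧ y₀) ℚ.* y₀ ℚ.* fromℤ d      ≡⟨ ℚ.*-assoc (fromℤ (↧ y₀)) y₀ (fromℤ d) ⟩
    fromℤ (↧ y₀) ℚ.* (y₀ ℚ.* fromℤ d)    ≡⟨ cong (fromℤ (↧ y₀) ℚ.*_) (ℚ.*-comm y₀ (fromℤ d)) ⟩
    fromℤ (↧ y₀) ℚ.* (fromℤ d ℚ.* y₀)    ≡⟨ ℚ.*-assoc (fromℤ (↧ y₀)) (fromℤ d) y₀ ⟨
    fromℤ (↧ y₀) ℚ.* fromℤ d ℚ.* y₀      ≡⟨ cong (ℚ._* y₀) (fromℤ-* (↧ y₀) d) ⟨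
    fromℤ (↧ y₀ * d) ℚ.* y₀              ∎
  Y′≡d′y (suc i) = sym (scaled-component Y (y ∘ suc) (↧ y₀) d Y≡dy i)

module _ {n : ℕ} (G : Graph n) where

  InKernelℤ : (Fin n → ℤ) → (Fin n → ℤ) → Set
  InKernelℤ lab x =
    ∀ i j k → i ≢ j → Adj G i j → lab i + lab j ≡ lab k → x i + x j ≡ x k

  nonzeroMultiple-inKernel : ∀ {lab Y y} → NonzeroMultiple Y y → InKernel G lab y → InKernelℤ lab Y
  nonzeroMultiple-inKernel {Y = Y} {y} (d , _ , Y≡dy) y∈ker i j k i≢j ij∈E sum≡ = fromℤ-injective (begin
    fromℤ (Y i + Y j)                      ≡⟨ fromℤ-+ (Y i) (Y j) ⟩
    fromℤ (Y i) ℚ.+ fromℤ (Y j)            ≡⟨ cong₂ ℚ._+_ (Y≡dy i) (Y≡dy j) ⟩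
    fromℤ d ℚ.* y i ℚ.+ fromℤ d ℚ.* y j    ≡⟨ ℚ.*-distribˡ-+ (fromℤ d) (y i) (y j) ⟨
    fromℤ d ℚ.* (y i ℚ.+ y j)              ≡⟨ cong (fromℤ d ℚ.*_) (y∈ker i j k i≢j ij∈E sum≡) ⟩
    fromℤ d ℚ.* y k                        ≡⟨ Y≡dy k ⟨
    fromℤ (Y k)                            ∎)

  nondegenerateKernelVector : ∀ {lab} → IsLabelling G lab → KernelDimAtLeast2 G lab →
    Σ (Fin n → ℤ) λ x → InKernelℤ lab x × ∃₂ λ p q → minor lab x p q ≢ 0ℤ
  nondegenerateKernelVector {lab} (injective , _) (u , v , u∈ker , v∈ker , indep)
    with clearDenominators u | clearDenominators v
  ... | U , U∼u | V , V∼v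
    with linIndep₂ℤ⇒minor≢0 (nonzeroMultiple-linIndep₂ U∼u V∼v indep)
  ... | p , q , UV≢0
    with minor lab U p q ≟ 0ℤ | minor lab V p q ≟ 0ℤ
  ... | no labU≢0 | _          = U , nonzeroMultiple-inKernel U∼u u∈ker , p , q , labU≢0
  ... | yes _     | no labV≢0  = V , nonzeroMultiple-inKernel V∼v v∈ker , p , q , labV≢0
  ... | yes labU≡0 | yes labV≡0 = ⊥-elim (minor≢0⇒distinct U V UV≢0 (injective (trans labp≡0 (sym labq≡0))))
    where
    labp≡0×labq≡0 : lab p ≡ 0ℤ × lab q ≡ 0ℤ
    labp≡0×labq≡0 = minor-vanishing U V lab UV≢0 labU≡0 labV≡0
    labp≡0 : lab p ≡ 0ℤ
    labp≡0 = proj₁ labp≡0×labq≡0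
    labq≡0 : lab q ≡ 0ℤ
    labq≡0 = proj₂ labp≡0×labq≡0

  shiftedLabelling : ∀ {lab x B N} → IsLabelling G lab → InKernelℤ lab x →
                     (∀ i → ∣ x i ∣ ≤ B) → B ℕ.+ B ℕ.+ B < N →
                     IsLabelling G (λ i → + N * lab i + x i)
  shiftedLabelling {lab} {x} {B} {N} (injective , adjacent⇔) x∈ker x≤B 3B<N = injective′ , adjacent⇔′
    where
    μ : Fin n → ℤ
    μ i = + N * lab i + x i
    difference-small : ∀ i j → ∣ x i - x j ∣ < N
    difference-small i j = ℕ.≤-<-trans
      (ℕ.≤-trans (ℤ.∣i-j∣≤∣i∣+∣j∣ (x i) (x j))
        (ℕ.≤-trans (ℕ.+-mono-≤ (x≤B i) (x≤B j)) (ℕ.m≤m+n (B ℕ.+ B) B)))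
      3B<N
    defect-small : ∀ i j k → ∣ (x i + x j) - x k ∣ < N
    defect-small i j k = ℕ.≤-<-trans
      (ℕ.≤-trans (ℤ.∣i-j∣≤∣i∣+∣j∣ (x i + x j) (x k))
        (ℕ.+-mono-≤ (ℕ.≤-trans (ℤ.∣i+j∣≤∣i∣+∣j∣ (x i) (x j)) (ℕ.+-mono-≤ (x≤B i) (x≤B j))) (x≤B k)))
      3B<N
    regroup : ∀ m a b c d → (m * a + b) + (m * c + d) ≡ m * (a + c) + (b + d)
    regroup = solve-∀
    injective′ : ∀ {i j} → μ i ≡ μ j → i ≡ j
    injective′ {i} {j} μi≡μj =
      injective (+N*a+b≡+N*c+d⇒a≡c (lab i) (x i) (lab j) (x j) (difference-small i j) μi≡μj)
    adjacent⇔′ : ∀ i j → i ≢ j → (Adj G i j ⇔ ∃ λ k → μ i + μ j ≡ μ k)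
    adjacent⇔′ i j i≢j = mk⇔ to from
      where
      to : Adj G i j → ∃ λ k → μ i + μ j ≡ μ k
      to ij∈E with Equivalence.to (adjacent⇔ i j i≢j) ij∈E
      ... | k , sum≡ = k , (begin
        μ i + μ j                             ≡⟨ regroup (+ N) (lab i) (x i) (lab j) (x j) ⟩
        + N * (lab i + lab j) + (x i + x j)   ≡⟨ cong₂ (λ a b → + N * a + b) sum≡ (x∈ker i j k i≢j ij∈E sum≡) ⟩
        μ k                                   ∎)
      from : (∃ λ k → μ i + μ j ≡ μ k) → Adj G i j
      from (k , sum≡) = Equivalence.from (adjacent⇔ i j i≢j) (k ,
        +N*a+b≡+N*c+d⇒a≡c (lab i + lab j) (x i + x j) (lab k) (x k) (defect-small i j k)
          (trans (sym (regroup (+ N) (lab i) (x i) (lab j) (x j))) sum≡))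

content : ∀ {n} → (Fin n → ℤ) → ℕ
content {ℕ.zero}  _ = 0
content {ℕ.suc n} x = gcd ∣ x zero ∣ (content (x ∘ suc))

content∣ : ∀ {n} (x : Fin n → ℤ) i → content x ℕ.∣ ∣ x i ∣
content∣ x zero    = gcd[m,n]∣m _ _
content∣ x (suc i) = ℕ.∣-trans (gcd[m,n]∣n ∣ x zero ∣ _) (content∣ (x ∘ suc) i)

∣content : ∀ {n} (x : Fin n → ℤ) {d} → (∀ i → d ℕ.∣ ∣ x i ∣) → d ℕ.∣ content x
∣content {ℕ.zero}  x {d} _   = d ℕ.∣0
∣content {ℕ.suc n} x     d∣x = gcd-greatest (d∣x zero) (∣content (x ∘ suc) (d∣x ∘ suc))

module _ {n : ℕ} (G : Graph n) where

  isLabelling-cancel : ∀ {μ ν g} → g ≢ 0ℤ → (∀ i → μ i ≡ g * ν i) →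
                       IsLabelling G μ → IsLabelling G ν
  isLabelling-cancel {μ} {ν} {g} g≢0 μ≡gν (injective , adjacent⇔) = injective′ , adjacent⇔′
    where
    instance _ = ℤ.≢-nonZero g≢0
    injective′ : ∀ {i j} → ν i ≡ ν j → i ≡ j
    injective′ {i} {j} νi≡νj = injective (trans (μ≡gν i) (trans (cong (g *_) νi≡νj) (sym (μ≡gν j))))
    sum-scales : ∀ i j → μ i + μ j ≡ g * (ν i + ν j)
    sum-scales i j = trans (cong₂ _+_ (μ≡gν i) (μ≡gν j)) (sym (ℤ.*-distribˡ-+ g (ν i) (ν j)))
    adjacent⇔′ : ∀ i j → i ≢ j → (Adj G i j ⇔ ∃ λ k → ν i + ν j ≡ ν k)
    adjacent⇔′ i j i≢j = mk⇔
      (λ ij∈E → let (k , sum≡) = Equivalence.to (adjacent⇔ i j i≢j) ij∈E in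
        k , ℤ.*-cancelˡ-≡ g _ _ (trans (sym (sum-scales i j)) (trans sum≡ (μ≡gν k))))
      (λ (k , sum≡) → Equivalence.from (adjacent⇔ i j i≢j)
        (k , trans (sum-scales i j) (trans (cong (g *_) sum≡) (sym (μ≡gν k)))))

  primitivePart : ∀ {μ p q} → IsLabelling G μ → p ≢ q →
    Σ (Fin n → ℤ) λ ν → IsLabelling G ν × IsPrimitive G ν × ∃ λ g → ∀ i → μ i ≡ g * ν i
  primitivePart {μ} {p} {q} μ-labelling p≢q = ν , ν-labelling , ν-primitive , + g , μ≡gν
    where
    g : ℕ
    g = content μ
    g≢0 : g ≢ 0
    g≢0 g≡0 = p≢q (proj₁ μ-labelling (trans (vanishes p) (sym (vanishes q))))
      where
      vanishes : ∀ i → μ i ≡ 0ℤ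
      vanishes i = ℤ.∣i∣≡0⇒i≡0 (ℕ.0∣⇒≡0 (subst (ℕ._∣ ∣ μ i ∣) g≡0 (content∣ μ i)))
    instance _ = ℕ.≢-nonZero g≢0
    g∣μ : ∀ i → + g ∣ μ i
    g∣μ i = ∣ᵤ⇒∣ {+ g} {μ i} (content∣ μ i)
    ν : Fin n → ℤ
    ν i = _∣_.quotient (g∣μ i)
    μ≡gν : ∀ i → μ i ≡ + g * ν i
    μ≡gν i = trans (_∣_.equality (g∣μ i)) (ℤ.*-comm (ν i) (+ g))
    ν-labelling : IsLabelling G ν
    ν-labelling = isLabelling-cancel {g = + g} (g≢0 ∘ cong ∣_∣) μ≡gν μ-labelling
    ν-primitive : IsPrimitive G ν
    ν-primitive (c , ρ , 1<∣c∣ , _ , ν≡cρ) = ℕ.<-irrefl (sym ∣c∣≡1) 1<∣c∣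
      where
      gc∣μ : ∀ i → g ℕ.* ∣ c ∣ ℕ.∣ ∣ μ i ∣
      gc∣μ i = ℕ.divides ∣ ρ i ∣ (begin
        ∣ μ i ∣                    ≡⟨ cong ∣_∣ (trans (μ≡gν i) (cong (+ g *_) (ν≡cρ i))) ⟩
        ∣ + g * (c * ρ i) ∣        ≡⟨ ℤ.abs-* (+ g) (c * ρ i) ⟩
        g ℕ.* ∣ c * ρ i ∣          ≡⟨ cong (g ℕ.*_) (ℤ.abs-* c (ρ i)) ⟩
        g ℕ.* (∣ c ∣ ℕ.* ∣ ρ i ∣)  ≡⟨ ℕ.*-assoc g ∣ c ∣ ∣ ρ i ∣ ⟨
        g ℕ.* ∣ c ∣ ℕ.* ∣ ρ i ∣    ≡⟨ ℕ.*-comm (g ℕ.* ∣ c ∣) ∣ ρ i ∣ ⟩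
        ∣ ρ i ∣ ℕ.* (g ℕ.* ∣ c ∣)  ∎)
      ∣c∣≡1 : ∣ c ∣ ≡ 1
      ∣c∣≡1 = ℕ.∣1⇒≡1 (ℕ.*-cancelˡ-∣ g (subst (g ℕ.* ∣ c ∣ ℕ.∣_) (sym (ℕ.*-identityʳ g)) (∣content μ gc∣μ)))

proportional-to-shift⇒vanishes : ∀ {n} (lab x l : Fin n → ℤ) {N g p q} →
  minor lab x p q ≢ 0ℤ → ∣ minor l x p q ∣ < N →
  (∀ i → + N * lab i + x i ≡ g * l i) → l p ≡ 0ℤ × l q ≡ 0ℤ
proportional-to-shift⇒vanishes lab x l {N} {g} {p} {q} lab∦x small μ≡gl =
  minor-vanishing lab x l lab∦x (proj₁ l∥lab×l∥x) (proj₂ l∥lab×l∥x)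
  where
  split : ∀ m lp lq ap aq xp xq →
          lp * (m * aq + xq) - lq * (m * ap + xp) ≡ m * (lp * aq - lq * ap) + (lp * xq - lq * xp)
  split = solve-∀
  proportional : ∀ g lp lq → lp * (g * lq) - lq * (g * lp) ≡ 0ℤ
  proportional = solve-∀
  l∥μ : minor l (λ i → + N * lab i + x i) p q ≡ 0ℤ
  l∥μ = begin
    minor l (λ i → + N * lab i + x i) p q  ≡⟨ cong₂ (λ s t → l p * s - l q * t) (μ≡gl q) (μ≡gl p) ⟩
    l p * (g * l q) - l q * (g * l p)      ≡⟨ proportional g (l p) (l q) ⟩
    0ℤ                                     ∎
  l∥lab×l∥x : minor l lab p q ≡ 0ℤ × minor l x p q ≡ 0ℤ
  l∥lab×l∥x = +N*a+b≡0⇒a≡0×b≡0 (minor l lab p q) (minor l x p q) small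
    (trans (sym (split (+ N) (l p) (l q) (lab p) (lab q) (x p) (x q))) l∥μ)

infinitelyManyPrimitiveLabellings : ∀ {n} (G : Graph n) {lab x p q} →
  IsLabelling G lab → InKernelℤ G lab x → minor lab x p q ≢ 0ℤ →
  InfinitelyManyPrimitiveLabellings G
infinitelyManyPrimitiveLabellings {n} G {lab} {x} {p} {q} lab-labelling x∈ker lab∦x L =
  let ν , ν-labelling , ν-primitive , g , μ≡gν = primitivePart G μ-labelling p≢q
  in  ν , ν-labelling , ν-primitive , All.tabulate (ν∉L {g = g} ν-labelling μ≡gν)
  where
  p≢q : p ≢ q
  p≢q = minor≢0⇒distinct lab x lab∦x
  B : ℕ
  B = sum (map (∣_∣ ∘ x) (allFin n))
  threshold : (Fin n → ℤ) → ℕ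
  threshold l = ∣ minor l x p q ∣
  N : ℕ
  N = ℕ.suc (B ℕ.+ B ℕ.+ B ℕ.+ sum (map threshold L))
  μ-labelling : IsLabelling G (λ i → + N * lab i + x i)
  μ-labelling = shiftedLabelling G lab-labelling x∈ker
    (λ i → ≤-sum-map (∣_∣ ∘ x) (∈-allFin i)) (ℕ.s≤s (ℕ.m≤m+n _ _))
  threshold<N : ∀ {l} → l ∈ L → threshold l < N
  threshold<N l∈L = ℕ.s≤s (ℕ.≤-trans (≤-sum-map threshold l∈L) (ℕ.m≤n+m _ _))
  ν∉L : ∀ {ν g} → IsLabelling G ν → (∀ i → + N * lab i + x i ≡ g * ν i) →
        ∀ {l} → l ∈ L → ¬ (∀ i → ν i ≡ l i)
  ν∉L {g = g} ν-labelling μ≡gν {l} l∈L ν≡l =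
    p≢q (proj₁ ν-labelling (trans (ν≡l p) (trans lp≡0 (sym (trans (ν≡l q) lq≡0)))))
    where
    lp≡0×lq≡0 : l p ≡ 0ℤ × l q ≡ 0ℤ
    lp≡0×lq≡0 = proportional-to-shift⇒vanishes lab x l {g = g} lab∦x (threshold<N l∈L)
                  (λ i → trans (μ≡gν i) (cong (g *_) (ν≡l i)))
    lp≡0 : l p ≡ 0ℤ
    lp≡0 = proj₁ lp≡0×lq≡0
    lq≡0 : l q ≡ 0ℤ
    lq≡0 = proj₂ lp≡0×lq≡0

-- The hypotheses 2 ≤ n and IsIntegralSumGraph G are implied by the kernel hypothesis.
mainTheorem8 : ∀ (n : ℕ) (G : Graph n) → 2 ≤ n → IsIntegralSumGraph G →
    HasKernelDimAtLeast2 G → InfinitelyManyPrimitiveLabellings G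
mainTheorem8 n G _ _ (lab , lab-labelling , kernel) =
  let x , x∈ker , p , q , lab∦x = nondegenerateKernelVector G lab-labelling kernel
  in  infinitelyManyPrimitiveLabellings G lab-labelling x∈ker lab∦x
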